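{- For every integer $n\ge 0$, $$\mathrm{LS}_n(112)=\mathrm{LS}_n(121)=\mathrm{RB}_n(121)=\mathrm{RB}_n(122)=\prod_{i=1}^{n-1}(1+q^i).$$
   Context: A restricted growth function (RGF) of length $n$ is a sequence $w=w_1\dots w_n$ of positive integers with $w_1=1$ and $w_i\le 1+\max\{w_1,\dots,w_{i-1}\}$ for $i\ge 2$ ($R_0$ consists of the empty word); $R_n$ is the set of RGFs of length $n$. The standardization of a word replaces every occurrence of its smallest letter by $1$, of its next smallest letter by $2$, and so on. An RGF $w$ contains an RGF $v$ if some subword (subsequence, not necessarily consecutive) of $w$ standardizes to $v$; otherwise $w$ avoids $v$. $R_n(v)$ is the set of $w\in R_n$ avoiding $v$. For a word $w$ and position $j$: $\mathrm{ls}(w_j)$ is the number of distinct values $w_i$ with $i<j$ and $w_i<w_j$; $\mathrm{rb}(w_j)$ is the number of distinct values $w_i$ with $i>j$ and $w_i>w_j$; $\mathrm{ls}(w)=\sum_j\mathrm{ls}(w_j)$, $\mathrm{rb}(w)=\sum_j\mathrm{rb}(w_j)$. Then $\mathrm{LS}_n(v)=\sum_{w\in R_n(v)}q^{\mathrm{ls}(w)}$ and $\mathrm{RB}_n(v)=\sum_{w\in R_n(v)}q^{\mathrm{rb}(w)}$. -}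

module Defs where

open import Data.Nat using (ℕ; zero; suc; _+_; _*_; _∸_; _<ᵇ_; _≡ᵇ_; _≤ᵇ_)
open import Data.Nat.Properties using (_≟_)
open import Data.Bool using (Bool; true; false; _∧_; _∨_; not; if_then_else_)
open import Data.List using (List; []; _∷_; map; length; concatMap; deduplicate; upTo; applyUpTo)
open import Data.Bool.ListAction using (any)
open import Data.Nat.ListAction using (sum)
open import Relation.Binary.PropositionalEquality using (_≡_)

bfilter : {A : Set} → (A → Bool) → List A → List A
bfilter p [] = []
bfilter p (x ∷ xs) = if p x then x ∷ bfilter p xs else bfilter p xs

-- Words are lists of positive integers (ℕ).

maxL : List ℕ → ℕ
maxL [] = 0
maxL (x ∷ xs) = Data.Nat._⊔_ x (maxL xs)

eqW : List ℕ → List ℕ → Bool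
eqW [] [] = true
eqW (x ∷ xs) (y ∷ ys) = (x ≡ᵇ y) ∧ eqW xs ys
eqW _ _ = false

-- RGF test, scanning left to right with the current maximum m (m = max of the prefix, 0 if empty)
-- w₁ = 1 is the case m = 0; in general each letter must satisfy 1 ≤ x ≤ 1 + m.
isRGF-from : ℕ → List ℕ → Bool
isRGF-from m [] = true
isRGF-from m (x ∷ xs) = (1 ≤ᵇ x) ∧ (x ≤ᵇ suc m) ∧ isRGF-from (Data.Nat._⊔_ m x) xs

isRGF : List ℕ → Bool
isRGF w = isRGF-from 0 w

wordsOver : ℕ → ℕ → List (List ℕ)
wordsOver m zero = [] ∷ []
wordsOver m (suc n) = concatMap (λ x → map (x ∷_) (wordsOver m n)) (applyUpTo suc m)

-- R n : the RGFs of length n (every letter of an RGF of length n is ≤ n)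
R : ℕ → List (List ℕ)
R n = bfilter isRGF (wordsOver n n)

distinct : List ℕ → ℕ
distinct xs = length (deduplicate _≟_ xs)

std : List ℕ → List ℕ
std w = map (λ x → suc (distinct (bfilter (λ y → y <ᵇ x) w))) w

subwords : List ℕ → List (List ℕ)
subwords [] = [] ∷ []
subwords (x ∷ xs) = let s = subwords xs in map (x ∷_) s Data.List.++ s

contains : List ℕ → List ℕ → Bool
contains w v = any (λ s → eqW (std s) v) (subwords w)

avoids : List ℕ → List ℕ → Bool
avoids w v = not (contains w v)

Rav : ℕ → List ℕ → List (List ℕ)
Rav n v = bfilter (λ w → avoids w v) (R n)

-- ls(w) = Σ_j #{distinct w_i : i < j, w_i < w_j}; `pre` is the prefix w_1 … w_{j-1}
ls-from : List ℕ → List ℕ → ℕ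
ls-from pre [] = 0
ls-from pre (x ∷ xs) = distinct (bfilter (λ y → y <ᵇ x) pre) + ls-from (x ∷ pre) xs

ls : List ℕ → ℕ
ls w = ls-from [] w

rb : List ℕ → ℕ
rb [] = 0
rb (x ∷ xs) = distinct (bfilter (λ y → x <ᵇ y) xs) + rb xs

-- Polynomials in q with ℕ coefficients, represented by their coefficient sequences
Poly : Set
Poly = ℕ → ℕ

-- generating polynomial Σ_{w ∈ ws} q^{stat w}
genPoly : (List ℕ → ℕ) → List (List ℕ) → Poly
genPoly stat ws k = length (bfilter (λ w → stat w ≡ᵇ k) ws)

LS : ℕ → List ℕ → Poly
LS n v = genPoly ls (Rav n v)

RB : ℕ → List ℕ → Poly
RB n v = genPoly rb (Rav n v)

onePoly : Poly
onePoly zero = 1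
onePoly (suc _) = 0

qPow : ℕ → Poly
qPow i k = if i ≡ᵇ k then 1 else 0

_⊕_ : Poly → Poly → Poly
(f ⊕ g) k = f k + g k

_⊗_ : Poly → Poly → Poly
(f ⊗ g) k = sum (map (λ j → f j * g (k ∸ j)) (upTo (suc k)))

prodFrom1 : ℕ → Poly
prodFrom1 zero = onePoly
prodFrom1 (suc m) = prodFrom1 m ⊗ (onePoly ⊕ qPow (suc m))

-- ∏_{i=1}^{n-1} (1 + q^i)   (empty product = 1 when n ≤ 1)
prodPoly : ℕ → Poly
prodPoly n = prodFrom1 (n ∸ 1)

_≋_ : Poly → Poly → Set
f ≋ g = ∀ k → f k ≡ g k

-- For n ≥ 1, each of the four sets R_{n+1}(v) is the disjoint union of two injective images of
-- R_n(v): one map preserves the statistic and the other raises it by n, so the generating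
-- polynomial satisfies P_{n+1} = (1 + q^n) P_n, with P_0 = P_1 = 1.
-- For ls the first map is w ↦ w1 (v = 112) or w ↦ 1w (v = 121), and the second is w ↦ 1(w+1):
-- raising all letters and prepending a 1 puts one more smaller value before each of the n old
-- letters. For rb the first map is w ↦ w1 (v = 122) or w ↦ w·max(w) (v = 121), and the second
-- appends the new maximum max(w)+1, one more larger value after each of the n old letters.
-- Avoidance forces every word of R_{n+1}(v) to arise this way, by restricting its last letter
-- (for ls and v = 121, its second letter).

module Submission where

open import Defs
open import Data.Bool using (Bool; true; false; T; _∧_)
open import Data.Bool.Properties using (T-∧; ∧-assoc)
open import Data.Empty using (⊥-elim)
open import Data.List
  using (List; []; _∷_; [_]; _++_; map; length; filter; filterᵇ; deduplicate; concatMap; applyUpTo; upTo;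
         cartesianProductWith; initLast; _∷ʳ′_)
open import Data.List.Properties
  using (length-map; length-++; filter-++; filter-all; ++-identityʳ; ∷-injective;
         ∷ʳ-injective; ∷ʳ-injectiveˡ; ∷ʳ-injectiveʳ; map-++; map-injective; map-cong; map-upTo)
open import Data.List.Membership.Propositional using (_∈_; _∉_; find; lose)
open import Data.List.Membership.Propositional.Properties
  using (∈-filter⁻; ∈-filter⁺; ∈-deduplicate⁻; ∈-deduplicate⁺; ∈-++⁻; ∈-++⁺ˡ; ∈-++⁺ʳ; ∈-map⁺; ∈-map⁻; ∈-length;
         ∈-cartesianProductWith⁺; ∈-cartesianProductWith⁻; ∈-applyUpTo⁺)
open import Data.List.Membership.Propositional.Properties.WithK using (unique∧set⇒bag)
open import Data.List.Relation.Binary.BagAndSetEquality using (_∼[_]_; set; bag-=⇒; ∷-cong; ∼bag⇒↭; ↭⇒∼bag)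
open import Data.List.Relation.Binary.Permutation.Propositional using (↭-refl; ↭-sym; swap)
open import Data.List.Relation.Binary.Permutation.Propositional.Properties using (↭-length; ∷↭∷ʳ)
open import Data.List.Relation.Binary.Sublist.Propositional
  using (_⊆_; []; _∷_; _∷ʳ_; ⊆-refl; ⊆-trans; minimum; lookup; from∈)
open import Data.List.Relation.Binary.Sublist.Propositional.Properties using (++⁺; ++⁺ʳ; map⁺)
open import Data.List.Relation.Unary.All as All using (All; []; _∷_)
open import Data.List.Relation.Unary.AllPairs using ([]; _∷_)
open import Data.List.Relation.Unary.Any using (here; there)
open import Data.List.Relation.Unary.Any.Properties using (any⁺; any⁻)
open import Data.List.Relation.Unary.Unique.Propositional using (Unique)
import Data.List.Relation.Unary.Unique.Propositional.Properties as Unique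
open import Data.Nat using (ℕ; zero; suc; _+_; _*_; _∸_; _≤_; _<_; z≤n; s≤s; z<s; _<ᵇ_; _≡ᵇ_; _≤ᵇ_; _⊔_)
open import Data.Nat.ListAction using (sum)
open import Data.Nat.Properties
open import Algebra.Properties.CommutativeSemigroup +-commutativeSemigroup
  using (x∙yz≈y∙xz) renaming (interchange to +-interchange)
open import Data.List.Membership.DecPropositional _≟_ using (_∈?_)
open import Data.List.Relation.Unary.Unique.DecPropositional.Properties _≟_ using (deduplicate-!)
open import Data.Product using (_×_; _,_; proj₁; proj₂; map₂; ∃-syntax)
open import Data.Sum using (_⊎_; inj₁; inj₂)
open import Function using (_∘_; case_of_; _⇔_; mk⇔; Equivalence)
open import Relation.Binary.Definitions using (tri<; tri≈; tri>)
open import Relation.Binary.PropositionalEquality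
  using (_≡_; _≢_; refl; sym; trans; cong; cong₂; subst; module ≡-Reasoning)
open import Relation.Nullary using (¬_; ¬?; Dec; yes; no; T?)

bfilter≡filterᵇ : {A : Set} (p : A → Bool) (xs : List A) → bfilter p xs ≡ filterᵇ p xs
bfilter≡filterᵇ p [] = refl
bfilter≡filterᵇ p (x ∷ xs) with p x
... | true = cong (x ∷_) (bfilter≡filterᵇ p xs)
... | false = bfilter≡filterᵇ p xs

module _ {A : Set} {p : A → Bool} where

  ∈-bfilter⁻ : ∀ {xs y} → y ∈ bfilter p xs → y ∈ xs × T (p y)
  ∈-bfilter⁻ {xs} rewrite bfilter≡filterᵇ p xs = ∈-filter⁻ (T? ∘ p)

  ∈-bfilter⁺ : ∀ {xs y} → y ∈ xs → T (p y) → y ∈ bfilter p xs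
  ∈-bfilter⁺ {xs} rewrite bfilter≡filterᵇ p xs = ∈-filter⁺ (T? ∘ p)

  bfilter-unique : ∀ {xs} → Unique xs → Unique (bfilter p xs)
  bfilter-unique {xs} rewrite bfilter≡filterᵇ p xs = Unique.filter⁺ (T? ∘ p)

module _ {A : Set} (p : A → Bool) where

  bfilter-++ : ∀ xs ys → bfilter p (xs ++ ys) ≡ bfilter p xs ++ bfilter p ys
  bfilter-++ xs ys rewrite bfilter≡filterᵇ p (xs ++ ys) | bfilter≡filterᵇ p xs | bfilter≡filterᵇ p ys =
    filter-++ (T? ∘ p) xs ys

  bfilter-++-[x]-accept : ∀ xs {x} → T (p x) → bfilter p (xs ++ [ x ]) ≡ bfilter p xs ++ [ x ]
  bfilter-++-[x]-accept xs {x} px with p x | bfilter-++ xs [ x ]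
  ... | true | eq = eq

  bfilter-++-[x]-reject : ∀ xs {x} → ¬ T (p x) → bfilter p (xs ++ [ x ]) ≡ bfilter p xs
  bfilter-++-[x]-reject xs {x} ¬px with p x | bfilter-++ xs [ x ]
  ... | true | _ = ⊥-elim (¬px _)
  ... | false | eq = trans eq (++-identityʳ (bfilter p xs))

unique-length-cong : {A : Set} {xs ys : List A} → Unique xs → Unique ys → xs ∼[ set ] ys → length xs ≡ length ys
unique-length-cong u v xs≈ys = ↭-length (∼bag⇒↭ (unique∧set⇒bag u v xs≈ys))

distinct-cong : {xs ys : List ℕ} → xs ∼[ set ] ys → distinct xs ≡ distinct ys
distinct-cong {xs} {ys} xs≈ys = unique-length-cong (deduplicate-! xs) (deduplicate-! ys) λ {z} →
  mk⇔ (∈-deduplicate⁺ _≟_ ∘ Equivalence.to xs≈ys ∘ ∈-deduplicate⁻ _≟_ xs)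
      (∈-deduplicate⁺ _≟_ ∘ Equivalence.from xs≈ys ∘ ∈-deduplicate⁻ _≟_ ys)

distinct-bfilter-cong : ∀ p {xs ys} → xs ∼[ set ] ys → distinct (bfilter p xs) ≡ distinct (bfilter p ys)
distinct-bfilter-cong p xs≈ys =
  distinct-cong (mk⇔ (restrict (Equivalence.to xs≈ys)) (restrict (Equivalence.from xs≈ys)))
  where
  restrict : ∀ {xs ys z} → (z ∈ xs → z ∈ ys) → z ∈ bfilter p xs → z ∈ bfilter p ys
  restrict xs⊆ys z∈ = let (z∈xs , pz) = ∈-bfilter⁻ z∈ in ∈-bfilter⁺ (xs⊆ys z∈xs) pz

distinct-∷-∈ : ∀ {x xs} → x ∈ xs → distinct (x ∷ xs) ≡ distinct xs
distinct-∷-∈ x∈xs = distinct-cong (mk⇔ (λ { (here refl) → x∈xs ; (there z∈) → z∈ }) there)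

distinct-∷-∉ : ∀ {x xs} → x ∉ xs → distinct (x ∷ xs) ≡ suc (distinct xs)
distinct-∷-∉ {x} {xs} x∉xs = cong (suc ∘ length) (filter-all (¬? ∘ (x ≟_)) x∉dedup)
  where
  x∉dedup : All (x ≢_) (deduplicate _≟_ xs)
  x∉dedup = All.tabulate λ z∈ x≡z → x∉xs (subst (_∈ xs) (sym x≡z) (∈-deduplicate⁻ _≟_ xs z∈))

distinct-++-[x] : ∀ xs x → distinct (xs ++ [ x ]) ≡ distinct (x ∷ xs)
distinct-++-[x] xs x = distinct-cong (bag-=⇒ (↭⇒∼bag (↭-sym (∷↭∷ʳ x xs))))

distinct-map : ∀ {f} → (∀ {x y} → f x ≡ f y → x ≡ y) → ∀ xs → distinct (map f xs) ≡ distinct xs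
distinct-map f-inj [] = refl
distinct-map {f} f-inj (x ∷ xs) with x ∈? xs
... | yes x∈xs = trans (distinct-∷-∈ (∈-map⁺ f x∈xs)) (trans (distinct-map f-inj xs) (sym (distinct-∷-∈ x∈xs)))
... | no x∉xs = trans (distinct-∷-∉ fx∉) (trans (cong suc (distinct-map f-inj xs)) (sym (distinct-∷-∉ x∉xs)))
  where
  fx∉ : f x ∉ map f xs
  fx∉ fx∈ with ∈-map⁻ f fx∈
  ... | y , y∈xs , fx≡fy = x∉xs (subst (_∈ xs) (sym (f-inj fx≡fy)) y∈xs)

distinct≡0⇒∉ : ∀ {xs z} → distinct xs ≡ 0 → z ∉ xs
distinct≡0⇒∉ d≡0 z∈xs = <⇒≢ (∈-length (∈-deduplicate⁺ _≟_ z∈xs)) (sym d≡0)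

distinct≡1⇒all≡ : ∀ {y ys z} → distinct (y ∷ ys) ≡ 1 → z ∈ ys → z ≡ y
distinct≡1⇒all≡ {y} {ys} {z} d≡1 z∈ys with z ≟ y
... | yes z≡y = z≡y
... | no z≢y = ⊥-elim (<⇒≢ (∈-length other∈) (sym (suc-injective d≡1)))
  where
  other∈ : z ∈ filter (¬? ∘ (y ≟_)) (deduplicate _≟_ ys)
  other∈ = ∈-filter⁺ (¬? ∘ (y ≟_)) (∈-deduplicate⁺ _≟_ z∈ys) (z≢y ∘ sym)

Pattern : Set₁
Pattern = ℕ → ℕ → ℕ → Set

Is112 Is121 Is122 : Pattern
Is112 a b c = a ≡ b × a < c
Is121 a b c = a ≡ c × a < b
Is122 a b c = b ≡ c × a < b

Represents : List ℕ → Pattern → Set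
Represents v P = ∀ a b c → T (eqW (std (a ∷ b ∷ c ∷ [])) v) ⇔ P a b c

opaque
  -- std w ≡ map (λ x → rank x w) w; opaque so that y and s can be inferred from rank y s.
  rank : ℕ → List ℕ → ℕ
  rank x w = suc (distinct (bfilter (_<ᵇ x) w))

  rank≡1⇒ : ∀ {y s} → rank y s ≡ 1 → ∀ {z} → z ∈ s → y ≤ z
  rank≡1⇒ r≡1 z∈s = ≮⇒≥ λ z<y → distinct≡0⇒∉ (suc-injective r≡1) (∈-bfilter⁺ z∈s (<⇒<ᵇ z<y))

  rank≡1⇐ : ∀ {y s} → (∀ {z} → z ∈ s → y ≤ z) → rank y s ≡ 1
  rank≡1⇐ {y} {s} y≤s = cong suc (distinct-cong {ys = []} (mk⇔ below (λ ())))
    where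
    below : ∀ {z} → z ∈ bfilter (_<ᵇ y) s → z ∈ []
    below z∈ with ∈-bfilter⁻ z∈
    ... | z∈s , z<y = ⊥-elim (<⇒≱ (<ᵇ⇒< _ _ z<y) (y≤s z∈s))

  rank≡2⇒ : ∀ {y s} → rank y s ≡ 2 → ∃[ z ] (z ∈ s × z < y × (∀ {t} → t ∈ s → t < y → t ≡ z))
  rank≡2⇒ {y} {s} r≡2 with bfilter (_<ᵇ y) s in eq
  ... | z ∷ zs with ∈-bfilter⁻ (subst (z ∈_) (sym eq) (here refl))
  ...   | z∈s , z<y = z , z∈s , <ᵇ⇒< _ _ z<y , only-z
    where
    only-z : ∀ {t} → t ∈ s → t < y → t ≡ z
    only-z {t} t∈s t<y with subst (t ∈_) eq (∈-bfilter⁺ t∈s (<⇒<ᵇ t<y))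
    ... | here t≡z = t≡z
    ... | there t∈zs = distinct≡1⇒all≡ (suc-injective r≡2) t∈zs

  rank≡2⇐ : ∀ {y s z} → z ∈ s → z < y → (∀ {t} → t ∈ s → t < y → t ≡ z) → rank y s ≡ 2
  rank≡2⇐ {y} {s} {z} z∈s z<y only-z = cong suc (distinct-cong {ys = [ z ]} (mk⇔ to from))
    where
    to : ∀ {t} → t ∈ bfilter (_<ᵇ y) s → t ∈ [ z ]
    to t∈ with ∈-bfilter⁻ t∈
    ... | t∈s , t<y = here (only-z t∈s (<ᵇ⇒< _ _ t<y))
    from : ∀ {t} → t ∈ [ z ] → t ∈ bfilter (_<ᵇ y) s
    from (here refl) = ∈-bfilter⁺ z∈s (<⇒<ᵇ z<y)

  std-abc⇔ranks : ∀ {a b c x y z} → let abc = a ∷ b ∷ c ∷ [] in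
                  T (eqW (std abc) (x ∷ y ∷ z ∷ [])) ⇔ (rank a abc ≡ x × rank b abc ≡ y × rank c abc ≡ z)
  std-abc⇔ranks = mk⇔
    (λ t → let (t₁ , t₂₃) = Equivalence.to T-∧ t ; (t₂ , t₃∧⊤) = Equivalence.to T-∧ t₂₃ in
      ≡ᵇ⇒≡ _ _ t₁ , ≡ᵇ⇒≡ _ _ t₂ , ≡ᵇ⇒≡ _ _ (proj₁ (Equivalence.to T-∧ t₃∧⊤)))
    (λ (e₁ , e₂ , e₃) → Equivalence.from T-∧ (≡⇒≡ᵇ _ _ e₁ ,
      Equivalence.from T-∧ (≡⇒≡ᵇ _ _ e₂ , Equivalence.from T-∧ (≡⇒≡ᵇ _ _ e₃ , _))))

represents-112 : Represents (1 ∷ 1 ∷ 2 ∷ []) Is112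
represents-112 a b c = mk⇔ (to ∘ Equivalence.to std-abc⇔ranks) (Equivalence.from std-abc⇔ranks ∘ from)
  where
  abc : List ℕ
  abc = a ∷ b ∷ c ∷ []
  to : rank a abc ≡ 1 × rank b abc ≡ 1 × rank c abc ≡ 2 → Is112 a b c
  to (r₁ , r₂ , r₃) with rank≡2⇒ r₃
  ... | z , z∈ , z<c , _ = ≤-antisym (rank≡1⇒ r₁ (there (here refl))) (rank≡1⇒ r₂ (here refl)) ,
                           ≤-<-trans (rank≡1⇒ r₁ z∈) z<c
  from : Is112 a b c → rank a abc ≡ 1 × rank b abc ≡ 1 × rank c abc ≡ 2
  from (refl , a<c) = rank-a , rank-a , rank≡2⇐ (here refl) a<c below-c
    where
    rank-a : rank a (a ∷ a ∷ c ∷ []) ≡ 1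
    rank-a = rank≡1⇐ λ { (here refl) → ≤-refl ; (there (here refl)) → ≤-refl ; (there (there (here refl))) → <⇒≤ a<c }
    below-c : ∀ {t} → t ∈ a ∷ a ∷ c ∷ [] → t < c → t ≡ a
    below-c (here t≡a) _ = t≡a
    below-c (there (here t≡a)) _ = t≡a
    below-c (there (there (here refl))) c<c = ⊥-elim (<-irrefl refl c<c)

represents-121 : Represents (1 ∷ 2 ∷ 1 ∷ []) Is121
represents-121 a b c = mk⇔ (to ∘ Equivalence.to std-abc⇔ranks) (Equivalence.from std-abc⇔ranks ∘ from)
  where
  abc : List ℕ
  abc = a ∷ b ∷ c ∷ []
  to : rank a abc ≡ 1 × rank b abc ≡ 2 × rank c abc ≡ 1 → Is121 a b c
  to (r₁ , r₂ , r₃) with rank≡2⇒ r₂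
  ... | z , z∈ , z<b , _ = ≤-antisym (rank≡1⇒ r₁ (there (there (here refl)))) (rank≡1⇒ r₃ (here refl)) ,
                           ≤-<-trans (rank≡1⇒ r₁ z∈) z<b
  from : Is121 a b c → rank a abc ≡ 1 × rank b abc ≡ 2 × rank c abc ≡ 1
  from (refl , a<b) = rank-a , rank≡2⇐ (here refl) a<b below-b , rank-a
    where
    rank-a : rank a (a ∷ b ∷ a ∷ []) ≡ 1
    rank-a = rank≡1⇐ λ { (here refl) → ≤-refl ; (there (here refl)) → <⇒≤ a<b ; (there (there (here refl))) → ≤-refl }
    below-b : ∀ {t} → t ∈ a ∷ b ∷ a ∷ [] → t < b → t ≡ a
    below-b (here t≡a) _ = t≡a
    below-b (there (here refl)) b<b = ⊥-elim (<-irrefl refl b<b)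
    below-b (there (there (here t≡a))) _ = t≡a

represents-122 : Represents (1 ∷ 2 ∷ 2 ∷ []) Is122
represents-122 a b c = mk⇔ (to ∘ Equivalence.to std-abc⇔ranks) (Equivalence.from std-abc⇔ranks ∘ from)
  where
  abc : List ℕ
  abc = a ∷ b ∷ c ∷ []
  to : rank a abc ≡ 1 × rank b abc ≡ 2 × rank c abc ≡ 2 → Is122 a b c
  to (r₁ , r₂ , r₃) with rank≡2⇒ r₂ | rank≡2⇒ r₃
  ... | z , z∈ , z<b , below-b | z′ , z′∈ , z′<c , below-c = b≡c , a<b
    where
    a<b : a < b
    a<b = ≤-<-trans (rank≡1⇒ r₁ z∈) z<b
    a<c : a < c
    a<c = ≤-<-trans (rank≡1⇒ r₁ z′∈) z′<c
    -- a is the only letter below b, and the only letter below c.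
    b≡c : b ≡ c
    b≡c with <-cmp b c
    ... | tri< b<c _ _ =
      ⊥-elim (<-irrefl (trans (below-c (here refl) a<c) (sym (below-c (there (here refl)) b<c))) a<b)
    ... | tri≈ _ b≡c _ = b≡c
    ... | tri> _ _ c<b =
      ⊥-elim (<-irrefl (trans (below-b (here refl) a<b) (sym (below-b (there (there (here refl))) c<b))) a<c)
  from : Is122 a b c → rank a abc ≡ 1 × rank b abc ≡ 2 × rank c abc ≡ 2
  from (refl , a<b) = rank-a , rank-b , rank-b
    where
    rank-a : rank a (a ∷ b ∷ b ∷ []) ≡ 1
    rank-a = rank≡1⇐ λ { (here refl) → ≤-refl ; (there (here refl)) → <⇒≤ a<b ; (there (there (here refl))) → <⇒≤ a<b }
    below-b : ∀ {t} → t ∈ a ∷ b ∷ b ∷ [] → t < b → t ≡ a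
    below-b (here t≡a) _ = t≡a
    below-b (there (here refl)) b<b = ⊥-elim (<-irrefl refl b<b)
    below-b (there (there (here refl))) b<b = ⊥-elim (<-irrefl refl b<b)
    rank-b : rank b (a ∷ b ∷ b ∷ []) ≡ 2
    rank-b = rank≡2⇐ (here refl) a<b below-b

∈-subwords⇔ : ∀ {s} w → s ∈ subwords w ⇔ s ⊆ w
∈-subwords⇔ w = mk⇔ (to w) (from w)
  where
  to : ∀ {s} w → s ∈ subwords w → s ⊆ w
  to [] (here refl) = []
  to (y ∷ w) s∈ with ∈-++⁻ (map (y ∷_) (subwords w)) s∈
  ... | inj₂ s∈ʳ = y ∷ʳ to w s∈ʳ
  ... | inj₁ s∈ˡ with ∈-map⁻ (y ∷_) s∈ˡ
  ...   | s′ , s′∈ , refl = refl ∷ to w s′∈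
  from : ∀ {s} w → s ⊆ w → s ∈ subwords w
  from [] [] = here refl
  from (y ∷ w) (.y ∷ʳ s⊆w) = ∈-++⁺ʳ (map (y ∷_) (subwords w)) (from w s⊆w)
  from (y ∷ w) (refl ∷ s⊆w) = ∈-++⁺ˡ (∈-map⁺ (y ∷_) (from w s⊆w))

eqW-length : ∀ xs ys → T (eqW xs ys) → length xs ≡ length ys
eqW-length [] [] _ = refl
eqW-length (x ∷ xs) (y ∷ ys) t = cong suc (eqW-length xs ys (proj₂ (Equivalence.to T-∧ t)))

Avoids : Pattern → List ℕ → Set
Avoids P w = ∀ {a b c} → a ∷ b ∷ c ∷ [] ⊆ w → ¬ P a b c

Avoids-⊆ : ∀ {P u w} → u ⊆ w → Avoids P w → Avoids P u
Avoids-⊆ u⊆w avoid abc⊆u = avoid (⊆-trans abc⊆u u⊆w)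

avoids⇔Avoids : ∀ {x y z P} → Represents (x ∷ y ∷ z ∷ []) P → ∀ w → T (avoids w (x ∷ y ∷ z ∷ [])) ⇔ Avoids P w
avoids⇔Avoids {x} {y} {z} {P} rep w = mk⇔ to from
  where
  v : List ℕ
  v = x ∷ y ∷ z ∷ []
  to : T (avoids w v) → Avoids P w
  to t abc⊆w p with contains w v | any⁺ (λ s → eqW (std s) v)
                                    (lose (Equivalence.from (∈-subwords⇔ w) abc⊆w) (Equivalence.from (rep _ _ _) p))
  ... | false | ()
  from : Avoids P w → T (avoids w v)
  from avoid with contains w v in eq
  ... | false = _
  ... | true with find (any⁻ (λ s → eqW (std s) v) (subwords w) (subst T (sym eq) _))
  ...   | s , s∈ , t with s | eqW-length (std s) v t | s∈ | t
  ...     | a ∷ b ∷ c ∷ [] | _ | abc∈ | t′ =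
    avoid (Equivalence.to (∈-subwords⇔ w) abc∈) (Equivalence.to (rep a b c) t′)

⊆-++-[z]⁻ : ∀ {A : Set} {s} (u : List A) {z} → s ⊆ u ++ [ z ] → s ⊆ u ⊎ ∃[ s′ ] (s ≡ s′ ++ [ z ] × s′ ⊆ u)
⊆-++-[z]⁻ [] {z} (.z ∷ʳ []) = inj₁ []
⊆-++-[z]⁻ [] (refl ∷ []) = inj₂ ([] , refl , [])
⊆-++-[z]⁻ (x ∷ u) (.x ∷ʳ s⊆) with ⊆-++-[z]⁻ u s⊆
... | inj₁ s⊆u = inj₁ (x ∷ʳ s⊆u)
... | inj₂ (s′ , refl , s′⊆u) = inj₂ (s′ , refl , x ∷ʳ s′⊆u)
⊆-++-[z]⁻ (x ∷ u) (refl ∷ s⊆) with ⊆-++-[z]⁻ u s⊆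
... | inj₁ s⊆u = inj₁ (refl ∷ s⊆u)
... | inj₂ (s′ , refl , s′⊆u) = inj₂ (x ∷ s′ , refl , refl ∷ s′⊆u)

⊆-map⁻ : ∀ {A B : Set} (f : A → B) {s} w → s ⊆ map f w → ∃[ s′ ] (s ≡ map f s′ × s′ ⊆ w)
⊆-map⁻ f [] [] = [] , refl , []
⊆-map⁻ f (x ∷ w) (.(f x) ∷ʳ s⊆) with ⊆-map⁻ f w s⊆
... | s′ , refl , s′⊆w = s′ , refl , x ∷ʳ s′⊆w
⊆-map⁻ f (x ∷ w) (refl ∷ s⊆) with ⊆-map⁻ f w s⊆
... | s′ , refl , s′⊆w = x ∷ s′ , refl , refl ∷ s′⊆w

FirstLetterRecurs LastLetterRecurs ShiftInvariant : Pattern → Set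
FirstLetterRecurs P = ∀ {a b c} → P a b c → a ≡ b ⊎ a ≡ c
LastLetterRecurs P = ∀ {a b c} → P a b c → c ≡ a ⊎ c ≡ b
ShiftInvariant P = ∀ {a b c} → P a b c ⇔ P (suc a) (suc b) (suc c)

Is112-shift : ShiftInvariant Is112
Is112-shift = mk⇔ (λ (a≡b , a<c) → cong suc a≡b , s≤s a<c) λ { (1+a≡1+b , s≤s a<c) → suc-injective 1+a≡1+b , a<c }

Is121-shift : ShiftInvariant Is121
Is121-shift = mk⇔ (λ (a≡c , a<b) → cong suc a≡c , s≤s a<b) λ { (1+a≡1+c , s≤s a<b) → suc-injective 1+a≡1+c , a<b }

-- Restricted growth functions

maxL-∈ : ∀ {x w} → x ∈ w → x ≤ maxL w
maxL-∈ {x} {y ∷ w} (here refl) = m≤m⊔n x (maxL w)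
maxL-∈ {x} {y ∷ w} (there x∈w) = ≤-trans (maxL-∈ x∈w) (m≤n⊔m y (maxL w))

maxL-++-[z] : ∀ u z → maxL (u ++ [ z ]) ≡ maxL u ⊔ z
maxL-++-[z] [] z = ⊔-identityʳ z
maxL-++-[z] (x ∷ u) z = trans (cong (x ⊔_) (maxL-++-[z] u z)) (sym (⊔-assoc x (maxL u) z))

isRGF-from-∷⇔ : ∀ {m x w} → T (isRGF-from m (x ∷ w)) ⇔ (1 ≤ x × x ≤ suc m × T (isRGF-from (m ⊔ x) w))
isRGF-from-∷⇔ {m} {x} = mk⇔
  (λ t → let (t₁ , t₂₃) = Equivalence.to T-∧ t ; (t₂ , t₃) = Equivalence.to T-∧ t₂₃ in
    ≤ᵇ⇒≤ 1 x t₁ , ≤ᵇ⇒≤ x (suc m) t₂ , t₃)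
  (λ (1≤x , x≤1+m , t) → Equivalence.from T-∧ (≤⇒≤ᵇ 1≤x , Equivalence.from T-∧ (≤⇒≤ᵇ x≤1+m , t)))

isRGF-from-++ : ∀ m u v → isRGF-from m (u ++ v) ≡ isRGF-from m u ∧ isRGF-from (m ⊔ maxL u) v
isRGF-from-++ m [] v = cong (λ k → isRGF-from k v) (sym (⊔-identityʳ m))
isRGF-from-++ m (x ∷ u) v = begin
  (1 ≤ᵇ x) ∧ (x ≤ᵇ suc m) ∧ isRGF-from (m ⊔ x) (u ++ v)
    ≡⟨ cong (λ b → (1 ≤ᵇ x) ∧ (x ≤ᵇ suc m) ∧ b) (isRGF-from-++ (m ⊔ x) u v) ⟩
  (1 ≤ᵇ x) ∧ (x ≤ᵇ suc m) ∧ isRGF-from (m ⊔ x) u ∧ isRGF-from (m ⊔ x ⊔ maxL u) v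
    ≡⟨ cong (λ k → (1 ≤ᵇ x) ∧ (x ≤ᵇ suc m) ∧ isRGF-from (m ⊔ x) u ∧ isRGF-from k v) (⊔-assoc m x (maxL u)) ⟩
  (1 ≤ᵇ x) ∧ (x ≤ᵇ suc m) ∧ isRGF-from (m ⊔ x) u ∧ isRGF-from (m ⊔ (x ⊔ maxL u)) v
    ≡⟨ cong ((1 ≤ᵇ x) ∧_) (sym (∧-assoc (x ≤ᵇ suc m) _ _)) ⟩
  (1 ≤ᵇ x) ∧ ((x ≤ᵇ suc m) ∧ isRGF-from (m ⊔ x) u) ∧ isRGF-from (m ⊔ (x ⊔ maxL u)) v
    ≡⟨ sym (∧-assoc (1 ≤ᵇ x) _ _) ⟩
  ((1 ≤ᵇ x) ∧ (x ≤ᵇ suc m) ∧ isRGF-from (m ⊔ x) u) ∧ isRGF-from (m ⊔ (x ⊔ maxL u)) v ∎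
  where open ≡-Reasoning

isRGF-++-[z]⇔ : ∀ {u z} → T (isRGF (u ++ [ z ])) ⇔ (T (isRGF u) × 1 ≤ z × z ≤ suc (maxL u))
isRGF-++-[z]⇔ {u} {z} rewrite isRGF-from-++ 0 u [ z ] = mk⇔
  (λ t → let (tu , tz) = Equivalence.to T-∧ t ; (1≤z , z≤ , _) = Equivalence.to (isRGF-from-∷⇔ {w = []}) tz in
    tu , 1≤z , z≤)
  (λ (tu , 1≤z , z≤) → Equivalence.from T-∧ (tu , Equivalence.from (isRGF-from-∷⇔ {w = []}) (1≤z , z≤ , _)))

isRGF-from⇒bounded : ∀ m w → T (isRGF-from m w) → All (λ x → 1 ≤ x × x ≤ m + length w) w
isRGF-from⇒bounded m [] _ = []
isRGF-from⇒bounded m (x ∷ w) t with Equivalence.to (isRGF-from-∷⇔ {w = w}) t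
... | 1≤x , x≤1+m , tw =
  (1≤x , ≤-trans x≤1+m 1+m≤) ∷ All.map (map₂ (λ y≤ → ≤-trans y≤ m⊔x+|w|≤)) (isRGF-from⇒bounded (m ⊔ x) w tw)
  where
  1+m≤ : suc m ≤ m + suc (length w)
  1+m≤ = subst (suc m ≤_) (sym (+-suc m (length w))) (s≤s (m≤m+n m (length w)))
  m⊔x+|w|≤ : m ⊔ x + length w ≤ m + suc (length w)
  m⊔x+|w|≤ = subst (m ⊔ x + length w ≤_) (sym (+-suc m (length w))) (+-monoˡ-≤ (length w) (⊔-lub (n≤1+n m) x≤1+m))

isRGF-from-map-suc : ∀ m w → All (1 ≤_) w → isRGF-from (suc m) (map suc w) ≡ isRGF-from m w
isRGF-from-map-suc m [] [] = refl
isRGF-from-map-suc m (suc x ∷ w) (_ ∷ 1≤w) = cong ((x <ᵇ suc m) ∧_) (isRGF-from-map-suc (m ⊔ suc x) w 1≤w)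

isRGF⇒head≡1 : ∀ {x w} → T (isRGF (x ∷ w)) → x ≡ 1
isRGF⇒head≡1 {w = w} t with Equivalence.to (isRGF-from-∷⇔ {w = w}) t
... | 1≤x , x≤1 , _ = ≤-antisym x≤1 1≤x

isRGF⇒positive : ∀ {w} → T (isRGF w) → All (1 ≤_) w
isRGF⇒positive {w} t = All.map proj₁ (isRGF-from⇒bounded 0 w t)

private
  ≤⊔⇒≤ʳ : ∀ {y x n} → y ≤ x ⊔ n → x < y → y ≤ n
  ≤⊔⇒≤ʳ {y} {x} {n} y≤x⊔n x<y with ⊔-sel x n
  ... | inj₁ x⊔n≡x = ⊥-elim (<⇒≱ x<y (subst (y ≤_) x⊔n≡x y≤x⊔n))
  ... | inj₂ x⊔n≡n = subst (y ≤_) x⊔n≡n y≤x⊔n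

isRGF-from⇒[y]⊆ : ∀ {m y} w → T (isRGF-from m w) → m < y → y ≤ maxL w → [ y ] ⊆ w
isRGF-from⇒[y]⊆ [] _ m<y y≤0 = ⊥-elim (<⇒≱ m<y (≤-trans y≤0 z≤n))
isRGF-from⇒[y]⊆ {m} {y} (x ∷ w) t m<y y≤max with Equivalence.to (isRGF-from-∷⇔ {w = w}) t | y ≤? x
... | _ , x≤1+m , _ | yes y≤x = ≤-antisym y≤x (≤-trans x≤1+m m<y) ∷ minimum w
... | _ , _ , tw | no y≰x = x ∷ʳ isRGF-from⇒[y]⊆ w tw (⊔-lub m<y (≰⇒> y≰x)) (≤⊔⇒≤ʳ y≤max (≰⇒> y≰x))

-- New values first occur in increasing order.
isRGF-from⇒[x,y]⊆ : ∀ {m x y} w → T (isRGF-from m w) → m < x → x < y → y ≤ maxL w → x ∷ y ∷ [] ⊆ w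
isRGF-from⇒[x,y]⊆ [] _ m<x x<y y≤0 = ⊥-elim (<⇒≱ (<-trans m<x x<y) (≤-trans y≤0 z≤n))
isRGF-from⇒[x,y]⊆ {m} {x} {y} (a ∷ w) t m<x x<y y≤max with Equivalence.to (isRGF-from-∷⇔ {w = w}) t | x ≤? a
... | _ , a≤1+m , tw | yes x≤a = x≡a ∷ isRGF-from⇒[y]⊆ w tw (⊔-lub (<-trans m<x x<y) a<y) (≤⊔⇒≤ʳ y≤max a<y)
  where
  x≡a : x ≡ a
  x≡a = ≤-antisym x≤a (≤-trans a≤1+m m<x)
  a<y : a < y
  a<y = subst (_< y) x≡a x<y
... | _ , _ , tw | no x≰a =
  a ∷ʳ isRGF-from⇒[x,y]⊆ w tw (⊔-lub m<x (≰⇒> x≰a)) x<y (≤⊔⇒≤ʳ y≤max (<-trans (≰⇒> x≰a) x<y))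

length-++-[z] : ∀ {A : Set} (u : List A) z → length (u ++ [ z ]) ≡ suc (length u)
length-++-[z] u z = trans (length-++ u) (+-comm (length u) 1)

snoc-view : ∀ {A : Set} {n} (w : List A) → length w ≡ suc n → ∃[ u ] ∃[ z ] (w ≡ u ++ [ z ] × length u ≡ n)
snoc-view w |w|≡1+n with initLast w
... | u ∷ʳ′ z = u , z , refl , suc-injective (trans (sym (length-++-[z] u z)) |w|≡1+n)

wordsOver-suc : ∀ m n → wordsOver m (suc n) ≡ cartesianProductWith _∷_ (applyUpTo suc m) (wordsOver m n)
wordsOver-suc m n = go (applyUpTo suc m)
  where
  go : ∀ xs → concatMap (λ x → map (x ∷_) (wordsOver m n)) xs ≡ cartesianProductWith _∷_ xs (wordsOver m n)
  go [] = refl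
  go (x ∷ xs) = cong (map (x ∷_) (wordsOver m n) ++_) (go xs)

∈-wordsOver⇒length : ∀ {m} n {w} → w ∈ wordsOver m n → length w ≡ n
∈-wordsOver⇒length zero (here refl) = refl
∈-wordsOver⇒length {m} (suc n) w∈ rewrite wordsOver-suc m n
  with _ , _ , _ , w′∈ , refl ← ∈-cartesianProductWith⁻ _∷_ (applyUpTo suc m) (wordsOver m n) w∈
  = cong suc (∈-wordsOver⇒length n w′∈)

∈-wordsOver⁺ : ∀ {m} w → All (λ x → 1 ≤ x × x ≤ m) w → w ∈ wordsOver m (length w)
∈-wordsOver⁺ [] [] = here refl
∈-wordsOver⁺ {m} (suc x ∷ w) ((_ , 1+x≤m) ∷ bounded) rewrite wordsOver-suc m (length w) =
  ∈-cartesianProductWith⁺ _∷_ (∈-applyUpTo⁺ suc 1+x≤m) (∈-wordsOver⁺ w bounded)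

wordsOver-unique : ∀ m n → Unique (wordsOver m n)
wordsOver-unique m zero = [] ∷ []
wordsOver-unique m (suc n) rewrite wordsOver-suc m n =
  Unique.cartesianProductWith⁺ _∷_ ∷-injective
    (Unique.applyUpTo⁺₁ suc m (λ i<j _ 1+i≡1+j → <⇒≢ i<j (suc-injective 1+i≡1+j))) (wordsOver-unique m n)

Rav-unique : ∀ n v → Unique (Rav n v)
Rav-unique n v = bfilter-unique (bfilter-unique (wordsOver-unique n n))

record AvoidingRGF (n : ℕ) (P : Pattern) (w : List ℕ) : Set where
  field
    length≡ : length w ≡ n
    rgf : T (isRGF w)
    avoids-P : Avoids P w

∈-Rav⇔ : ∀ {x y z P n w} → Represents (x ∷ y ∷ z ∷ []) P → w ∈ Rav n (x ∷ y ∷ z ∷ []) ⇔ AvoidingRGF n P w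
∈-Rav⇔ {x} {y} {z} {P} {n} {w} rep = mk⇔ to from
  where
  to : w ∈ Rav n (x ∷ y ∷ z ∷ []) → AvoidingRGF n P w
  to w∈ with ∈-bfilter⁻ w∈
  ... | w∈R , avoids-v with ∈-bfilter⁻ w∈R
  ...   | w∈W , rgf = record
    { length≡ = ∈-wordsOver⇒length n w∈W ; rgf = rgf ; avoids-P = Equivalence.to (avoids⇔Avoids rep w) avoids-v }
  from : AvoidingRGF n P w → w ∈ Rav n (x ∷ y ∷ z ∷ [])
  from record { length≡ = refl ; rgf = rgf ; avoids-P = avoid } =
    ∈-bfilter⁺ (∈-bfilter⁺ (∈-wordsOver⁺ w (isRGF-from⇒bounded 0 w rgf)) rgf)
               (Equivalence.from (avoids⇔Avoids rep w) avoid)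

module _ {P : Pattern} where

  AvoidingRGF⇒positive : ∀ {n w} → AvoidingRGF n P w → All (1 ≤_) w
  AvoidingRGF⇒positive w-avoids = isRGF⇒positive (AvoidingRGF.rgf w-avoids)

  AvoidingRGF-init : ∀ {n u z} → AvoidingRGF (suc n) P (u ++ [ z ]) → AvoidingRGF n P u
  AvoidingRGF-init {u = u} {z} uz-avoids = record
    { length≡ = suc-injective (trans (sym (length-++-[z] u z)) length≡)
    ; rgf = proj₁ (Equivalence.to (isRGF-++-[z]⇔ {u} {z}) rgf)
    ; avoids-P = Avoids-⊆ (++⁺ʳ [ z ] ⊆-refl) avoids-P
    }
    where open AvoidingRGF uz-avoids

  AvoidingRGF-++-[z] : ∀ {n u z} → AvoidingRGF n P u → 1 ≤ z → z ≤ suc (maxL u) →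
                       (∀ {a b} → a ∷ b ∷ [] ⊆ u → ¬ P a b z) → AvoidingRGF (suc n) P (u ++ [ z ])
  AvoidingRGF-++-[z] {u = u} {z} u-avoids 1≤z z≤ no-end-at-z = record
    { length≡ = trans (length-++-[z] u z) (cong suc length≡)
    ; rgf = Equivalence.from (isRGF-++-[z]⇔ {u} {z}) (rgf , 1≤z , z≤)
    ; avoids-P = avoid
    }
    where
    open AvoidingRGF u-avoids
    avoid : Avoids P (u ++ [ z ])
    avoid abc⊆ with ⊆-++-[z]⁻ u abc⊆
    ... | inj₁ abc⊆u = avoids-P abc⊆u
    ... | inj₂ (s′ , eq , s′⊆u) with ∷ʳ-injective (_ ∷ _ ∷ []) s′ eq
    ...   | refl , refl = no-end-at-z s′⊆u

  AvoidingRGF-unsnoc : ∀ {n w} → AvoidingRGF (suc n) P w →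
                       ∃[ u ] ∃[ z ] (w ≡ u ++ [ z ] × AvoidingRGF n P u × 1 ≤ z × z ≤ suc (maxL u))
  AvoidingRGF-unsnoc {w = w} w-avoids with snoc-view w (AvoidingRGF.length≡ w-avoids)
  ... | u , z , refl , _ with Equivalence.to (isRGF-++-[z]⇔ {u} {z}) (AvoidingRGF.rgf w-avoids)
  ...   | _ , 1≤z , z≤ = u , z , refl , AvoidingRGF-init w-avoids , 1≤z , z≤

  AvoidingRGF-head : ∀ {n w} → AvoidingRGF (suc n) P w → ∃[ r ] (w ≡ 1 ∷ r)
  AvoidingRGF-head {w = x ∷ r} record { rgf = rgf } with isRGF⇒head≡1 {x} {r} rgf
  ... | refl = r , refl

  AvoidingRGF⇒1≤maxL : ∀ {n w} → AvoidingRGF (suc n) P w → 1 ≤ maxL w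
  AvoidingRGF⇒1≤maxL w-avoids with AvoidingRGF-head w-avoids
  ... | r , refl = m≤m⊔n 1 (maxL r)

rb-++-[x]-min : ∀ x w → All (x ≤_) w → rb (w ++ [ x ]) ≡ rb w
rb-++-[x]-min x [] [] = refl
rb-++-[x]-min x (y ∷ w) (x≤y ∷ x≤w) =
  cong₂ _+_ (cong distinct (bfilter-++-[x]-reject (y <ᵇ_) w (λ y<x → <⇒≱ (<ᵇ⇒< y x y<x) x≤y)))
            (rb-++-[x]-min x w x≤w)

rb-++-[x]-max : ∀ x w → All (_< x) w → rb (w ++ [ x ]) ≡ length w + rb w
rb-++-[x]-max x [] [] = refl
rb-++-[x]-max x (y ∷ w) (y<x ∷ w<x) = begin
  distinct (bfilter (y <ᵇ_) (w ++ [ x ])) + rb (w ++ [ x ])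
    ≡⟨ cong₂ _+_ (cong distinct (bfilter-++-[x]-accept (y <ᵇ_) w (<⇒<ᵇ y<x))) (rb-++-[x]-max x w w<x) ⟩
  distinct (bfilter (y <ᵇ_) w ++ [ x ]) + (length w + rb w)
    ≡⟨ cong (_+ (length w + rb w)) (trans (distinct-++-[x] (bfilter (y <ᵇ_) w) x) (distinct-∷-∉ x∉)) ⟩
  suc (distinct (bfilter (y <ᵇ_) w) + (length w + rb w))
    ≡⟨ cong suc (x∙yz≈y∙xz (distinct (bfilter (y <ᵇ_) w)) (length w) (rb w)) ⟩
  suc (length w + (distinct (bfilter (y <ᵇ_) w) + rb w)) ∎
  where
  open ≡-Reasoning
  x∉ : x ∉ bfilter (y <ᵇ_) w
  x∉ x∈ = <-irrefl refl (All.lookup w<x (proj₁ (∈-bfilter⁻ x∈)))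

rb-++-[x,x] : ∀ x u → rb ((u ++ [ x ]) ++ [ x ]) ≡ rb (u ++ [ x ])
rb-++-[x,x] x [] =
  cong (_+ 0) (cong distinct (bfilter-++-[x]-reject (x <ᵇ_) [] {x} (λ x<x → <-irrefl refl (<ᵇ⇒< x x x<x))))
rb-++-[x,x] x (y ∷ u) = cong₂ _+_ (distinct-bfilter-cong (y <ᵇ_) (mk⇔ to ∈-++⁺ˡ)) (rb-++-[x,x] x u)
  where
  to : ∀ {z} → z ∈ (u ++ [ x ]) ++ [ x ] → z ∈ u ++ [ x ]
  to z∈ with ∈-++⁻ (u ++ [ x ]) z∈
  ... | inj₁ z∈ux = z∈ux
  ... | inj₂ (here refl) = ∈-++⁺ʳ u (here refl)

ls-from-cong : ∀ {pre pre′} w → pre ∼[ set ] pre′ → ls-from pre w ≡ ls-from pre′ w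
ls-from-cong [] _ = refl
ls-from-cong (y ∷ w) pre≈pre′ =
  cong₂ _+_ (distinct-bfilter-cong (_<ᵇ y) pre≈pre′) (ls-from-cong w (∷-cong refl pre≈pre′))

ls-from-++-[x]-min : ∀ x pre w → All (x ≤_) pre → All (x ≤_) w → ls-from pre (w ++ [ x ]) ≡ ls-from pre w
ls-from-++-[x]-min x pre [] x≤pre [] = cong (_+ 0) (distinct-cong {ys = []} (mk⇔ below-x (λ ())))
  where
  below-x : ∀ {z} → z ∈ bfilter (_<ᵇ x) pre → z ∈ []
  below-x z∈ = let (z∈pre , z<x) = ∈-bfilter⁻ z∈ in ⊥-elim (<⇒≱ (<ᵇ⇒< _ x z<x) (All.lookup x≤pre z∈pre))
ls-from-++-[x]-min x pre (y ∷ w) x≤pre (x≤y ∷ x≤w) = cong (_ +_) (ls-from-++-[x]-min x (y ∷ pre) w (x≤y ∷ x≤pre) x≤w)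

ls-from-1∷map-suc : ∀ pre w → All (1 ≤_) pre → All (1 ≤_) w →
                    ls-from (1 ∷ map suc pre) (map suc w) ≡ length w + ls-from pre w
ls-from-1∷map-suc pre [] _ [] = refl
ls-from-1∷map-suc pre (suc y ∷ w) 1≤pre (1≤1+y ∷ 1≤w) = begin
  distinct (1 ∷ bfilter (_<ᵇ suc (suc y)) (map suc pre)) + ls-from (suc (suc y) ∷ 1 ∷ map suc pre) (map suc w)
    ≡⟨ cong₂ _+_ (cong (distinct ∘ (1 ∷_)) (bfilter-map-suc pre))
                 (ls-from-cong (map suc w) (bag-=⇒ (↭⇒∼bag (swap (suc (suc y)) 1 ↭-refl)))) ⟩
  distinct (1 ∷ map suc (bfilter (_<ᵇ suc y) pre)) + ls-from (1 ∷ map suc (suc y ∷ pre)) (map suc w)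
    ≡⟨ cong₂ _+_ (trans (distinct-∷-∉ 1∉) (cong suc (distinct-map suc-injective (bfilter (_<ᵇ suc y) pre))))
                 (ls-from-1∷map-suc (suc y ∷ pre) w (1≤1+y ∷ 1≤pre) 1≤w) ⟩
  suc (distinct (bfilter (_<ᵇ suc y) pre) + (length w + ls-from (suc y ∷ pre) w))
    ≡⟨ cong suc (x∙yz≈y∙xz (distinct (bfilter (_<ᵇ suc y) pre)) (length w) _) ⟩
  suc (length w + (distinct (bfilter (_<ᵇ suc y) pre) + ls-from (suc y ∷ pre) w)) ∎
  where
  open ≡-Reasoning
  bfilter-map-suc : ∀ xs → bfilter (_<ᵇ suc (suc y)) (map suc xs) ≡ map suc (bfilter (_<ᵇ suc y) xs)
  bfilter-map-suc [] = refl
  bfilter-map-suc (x ∷ xs) with x <ᵇ suc y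
  ... | true = cong (suc x ∷_) (bfilter-map-suc xs)
  ... | false = bfilter-map-suc xs
  1∉ : 1 ∉ map suc (bfilter (_<ᵇ suc y) pre)
  1∉ 1∈ with ∈-map⁻ suc 1∈
  ... | 0 , 0∈ , refl = <-irrefl refl (All.lookup 1≤pre (proj₁ (∈-bfilter⁻ 0∈)))

-- Generating polynomials

shiftPoly : ℕ → Poly → Poly
shiftPoly zero f k = f k
shiftPoly (suc s) f zero = 0
shiftPoly (suc s) f (suc k) = shiftPoly s f k

shiftPoly-cong : ∀ s {f g} → f ≋ g → shiftPoly s f ≋ shiftPoly s g
shiftPoly-cong zero f≋g k = f≋g k
shiftPoly-cong (suc s) f≋g zero = refl
shiftPoly-cong (suc s) f≋g (suc k) = shiftPoly-cong s f≋g k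

shiftPoly-≤ : ∀ s f {k} → s ≤ k → shiftPoly s f k ≡ f (k ∸ s)
shiftPoly-≤ zero f _ = refl
shiftPoly-≤ (suc s) f (s≤s s≤k) = shiftPoly-≤ s f s≤k

shiftPoly-< : ∀ s f {k} → k < s → shiftPoly s f k ≡ 0
shiftPoly-< (suc s) f {zero} _ = refl
shiftPoly-< (suc s) f {suc k} (s≤s k<s) = shiftPoly-< s f k<s

genPoly-+ : ∀ s stat ws → genPoly ((s +_) ∘ stat) ws ≋ shiftPoly s (genPoly stat ws)
genPoly-+ zero stat ws k = refl
genPoly-+ (suc s) stat ws zero = none ws
  where
  none : ∀ ws → genPoly ((suc s +_) ∘ stat) ws 0 ≡ 0
  none [] = refl
  none (_ ∷ ws) = none ws
genPoly-+ (suc s) stat ws (suc k) = genPoly-+ s stat ws k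

qPow-refl : ∀ i → qPow i i ≡ 1
qPow-refl zero = refl
qPow-refl (suc i) = qPow-refl i

qPow-≢ : ∀ i k → i ≢ k → qPow i k ≡ 0
qPow-≢ zero zero 0≢0 = ⊥-elim (0≢0 refl)
qPow-≢ zero (suc k) _ = refl
qPow-≢ (suc i) zero _ = refl
qPow-≢ (suc i) (suc k) 1+i≢1+k = qPow-≢ i k (1+i≢1+k ∘ cong suc)

sum-map-+ : ∀ (a b : ℕ → ℕ) js → sum (map (λ j → a j + b j) js) ≡ sum (map a js) + sum (map b js)
sum-map-+ a b [] = refl
sum-map-+ a b (j ∷ js) = trans (cong (a j + b j +_) (sum-map-+ a b js)) (+-interchange (a j) (b j) _ _)

sum-applyUpTo-zero : ∀ (g : ℕ → ℕ) n → (∀ i → i < n → g i ≡ 0) → sum (applyUpTo g n) ≡ 0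
sum-applyUpTo-zero g zero _ = refl
sum-applyUpTo-zero g (suc n) g≡0 =
  cong₂ _+_ (g≡0 0 z<s) (sum-applyUpTo-zero (g ∘ suc) n (λ i i<n → g≡0 (suc i) (s≤s i<n)))

sum-applyUpTo-single : ∀ (g : ℕ → ℕ) n t → t < n → (∀ i → i < n → i ≢ t → g i ≡ 0) → sum (applyUpTo g n) ≡ g t
sum-applyUpTo-single g (suc n) zero _ g≡0 =
  trans (cong (g 0 +_) (sum-applyUpTo-zero (g ∘ suc) n (λ i i<n → g≡0 (suc i) (s≤s i<n) λ ()))) (+-identityʳ (g 0))
sum-applyUpTo-single g (suc n) (suc t) (s≤s t<n) g≡0 =
  cong₂ _+_ (g≡0 0 z<s λ ())
            (sum-applyUpTo-single (g ∘ suc) n t t<n (λ i i<n i≢t → g≡0 (suc i) (s≤s i<n) (i≢t ∘ suc-injective)))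

⊗-distribˡ-⊕ : ∀ f g h → (f ⊗ (g ⊕ h)) ≋ ((f ⊗ g) ⊕ (f ⊗ h))
⊗-distribˡ-⊕ f g h k = trans (cong sum (map-cong (λ j → *-distribˡ-+ (f j) (g (k ∸ j)) (h (k ∸ j))) (upTo (suc k))))
                              (sum-map-+ (λ j → f j * g (k ∸ j)) (λ j → f j * h (k ∸ j)) (upTo (suc k)))

⊗-qPow : ∀ f s → (f ⊗ qPow s) ≋ shiftPoly s f
⊗-qPow f s k = trans (cong sum (map-upTo term (suc k))) (sum-terms (s ≤? k))
  where
  open ≡-Reasoning
  term : ℕ → ℕ
  term j = f j * qPow s (k ∸ j)
  sum-terms : Dec (s ≤ k) → sum (applyUpTo term (suc k)) ≡ shiftPoly s f k
  sum-terms (yes s≤k) = begin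
    sum (applyUpTo term (suc k))
      ≡⟨ sum-applyUpTo-single term (suc k) (k ∸ s) (s≤s (m∸n≤m k s)) other-terms ⟩
    f (k ∸ s) * qPow s (k ∸ (k ∸ s))
      ≡⟨ cong (λ i → f (k ∸ s) * qPow s i) (m∸[m∸n]≡n s≤k) ⟩
    f (k ∸ s) * qPow s s
      ≡⟨ cong (f (k ∸ s) *_) (qPow-refl s) ⟩
    f (k ∸ s) * 1
      ≡⟨ *-identityʳ (f (k ∸ s)) ⟩
    f (k ∸ s)
      ≡⟨ shiftPoly-≤ s f s≤k ⟨
    shiftPoly s f k ∎
    where
    other-terms : ∀ j → j < suc k → j ≢ k ∸ s → term j ≡ 0
    other-terms j (s≤s j≤k) j≢k∸s =
      trans (cong (f j *_) (qPow-≢ s (k ∸ j) λ s≡k∸j → j≢k∸s (trans (sym (m∸[m∸n]≡n j≤k)) (cong (k ∸_) (sym s≡k∸j)))))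
            (*-zeroʳ (f j))
  sum-terms (no s≰k) = trans (sum-applyUpTo-zero term (suc k) zero-terms) (sym (shiftPoly-< s f (≰⇒> s≰k)))
    where
    zero-terms : ∀ j → j < suc k → term j ≡ 0
    zero-terms j _ =
      trans (cong (f j *_) (qPow-≢ s (k ∸ j) λ s≡k∸j → s≰k (subst (_≤ k) (sym s≡k∸j) (m∸n≤m k j)))) (*-zeroʳ (f j))

⊗-congʳ : ∀ f {g h} → g ≋ h → (f ⊗ g) ≋ (f ⊗ h)
⊗-congʳ f g≋h k = cong sum (map-cong (λ j → cong (f j *_) (g≋h (k ∸ j))) (upTo (suc k)))

⊗-onePoly : ∀ f → (f ⊗ onePoly) ≋ f
⊗-onePoly f k = trans (⊗-congʳ f onePoly≋qPow0 k) (⊗-qPow f 0 k)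
  where
  onePoly≋qPow0 : onePoly ≋ qPow 0
  onePoly≋qPow0 zero = refl
  onePoly≋qPow0 (suc _) = refl

prodFrom1-suc : ∀ m → prodFrom1 (suc m) ≋ (prodFrom1 m ⊕ shiftPoly (suc m) (prodFrom1 m))
prodFrom1-suc m k = begin
  (prodFrom1 m ⊗ (onePoly ⊕ qPow (suc m))) k      ≡⟨ ⊗-distribˡ-⊕ (prodFrom1 m) onePoly (qPow (suc m)) k ⟩
  (prodFrom1 m ⊗ onePoly) k + (prodFrom1 m ⊗ qPow (suc m)) k
    ≡⟨ cong₂ _+_ (⊗-onePoly (prodFrom1 m) k) (⊗-qPow (prodFrom1 m) (suc m) k) ⟩
  prodFrom1 m k + shiftPoly (suc m) (prodFrom1 m) k ∎
  where open ≡-Reasoning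

record Splitting (stat : List ℕ → ℕ) (s : ℕ) (A B : List ℕ → Set) : Set where
  field
    left right : List ℕ → List ℕ
    left-injective : ∀ {u w} → left u ≡ left w → u ≡ w
    right-injective : ∀ {u w} → right u ≡ right w → u ≡ w
    left-∈ : ∀ {w} → A w → B (left w)
    right-∈ : ∀ {w} → A w → B (right w)
    left≢right : ∀ {u w} → A u → A w → left u ≢ right w
    split : ∀ {w′} → B w′ → ∃[ w ] (A w × (w′ ≡ left w ⊎ w′ ≡ right w))
    stat-left : ∀ {w} → A w → stat (left w) ≡ stat w
    stat-right : ∀ {w} → A w → stat (right w) ≡ s + stat w

graded : (List ℕ → ℕ) → ℕ → List (List ℕ) → List (List ℕ)
graded stat k = bfilter (λ w → stat w ≡ᵇ k)

module _ {stat s A B as bs} (as⇔A : ∀ {w} → w ∈ as ⇔ A w) (bs⇔B : ∀ {w} → w ∈ bs ⇔ B w)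
         (S : Splitting stat s A B) (k : ℕ) where

  open Splitting S

  private
    images : List (List ℕ)
    images = map left (graded stat k as) ++ map right (graded ((s +_) ∘ stat) k as)

    transport : ∀ {m n} → m ≡ n → T (n ≡ᵇ k) → T (m ≡ᵇ k)
    transport m≡n = subst (λ t → T (t ≡ᵇ k)) (sym m≡n)

    A-of : ∀ f {w} → w ∈ graded f k as → A w
    A-of f w∈ = Equivalence.to as⇔A (proj₁ (∈-bfilter⁻ {p = λ w → f w ≡ᵇ k} {as} w∈))

  images-unique : Unique as → Unique images
  images-unique as-unique = Unique.++⁺ (Unique.map⁺ left-injective (bfilter-unique as-unique))
                                       (Unique.map⁺ right-injective (bfilter-unique as-unique)) disjoint
    where
    disjoint : ∀ {w′} → ¬ (w′ ∈ map left (graded stat k as) × w′ ∈ map right (graded ((s +_) ∘ stat) k as))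
    disjoint (w′∈ˡ , w′∈ʳ) with ∈-map⁻ left w′∈ˡ | ∈-map⁻ right w′∈ʳ
    ... | u , u∈ , refl | w , w∈ , lu≡rw = left≢right (A-of stat u∈) (A-of ((s +_) ∘ stat) w∈) lu≡rw

  graded∼images : graded stat k bs ∼[ set ] images
  graded∼images = mk⇔ to from
    where
    to : ∀ {w′} → w′ ∈ graded stat k bs → w′ ∈ images
    to w′∈ with ∈-bfilter⁻ w′∈
    ... | w′∈bs , stat≡k with split (Equivalence.to bs⇔B w′∈bs)
    ...   | w , Aw , inj₁ refl =
      ∈-++⁺ˡ (∈-map⁺ left (∈-bfilter⁺ (Equivalence.from as⇔A Aw) (transport (sym (stat-left Aw)) stat≡k)))
    ...   | w , Aw , inj₂ refl = ∈-++⁺ʳ (map left (graded stat k as))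
      (∈-map⁺ right (∈-bfilter⁺ (Equivalence.from as⇔A Aw) (transport (sym (stat-right Aw)) stat≡k)))
    from : ∀ {w′} → w′ ∈ images → w′ ∈ graded stat k bs
    from w′∈ with ∈-++⁻ (map left (graded stat k as)) w′∈
    ... | inj₁ w′∈ˡ with ∈-map⁻ left w′∈ˡ
    ...   | w , w∈ , refl = ∈-bfilter⁺ (Equivalence.from bs⇔B (left-∈ (A-of stat w∈)))
      (transport (stat-left (A-of stat w∈)) (proj₂ (∈-bfilter⁻ {p = λ w → stat w ≡ᵇ k} {as} w∈)))
    from w′∈ | inj₂ w′∈ʳ with ∈-map⁻ right w′∈ʳ
    ...   | w , w∈ , refl = ∈-bfilter⁺ (Equivalence.from bs⇔B (right-∈ (A-of ((s +_) ∘ stat) w∈)))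
      (transport (stat-right (A-of ((s +_) ∘ stat) w∈)) (proj₂ (∈-bfilter⁻ {p = λ w → s + stat w ≡ᵇ k} {as} w∈)))

  genPoly-splitting : Unique as → Unique bs → genPoly stat bs k ≡ (genPoly stat as ⊕ shiftPoly s (genPoly stat as)) k
  genPoly-splitting as-unique bs-unique = begin
    length (graded stat k bs)
      ≡⟨ unique-length-cong (bfilter-unique bs-unique) (images-unique as-unique) graded∼images ⟩
    length images
      ≡⟨ length-++ (map left (graded stat k as)) ⟩
    length (map left (graded stat k as)) + length (map right (graded ((s +_) ∘ stat) k as))
      ≡⟨ cong₂ _+_ (length-map left (graded stat k as)) (length-map right (graded ((s +_) ∘ stat) k as)) ⟩
    genPoly stat as k + genPoly ((s +_) ∘ stat) as k
      ≡⟨ cong (genPoly stat as k +_) (genPoly-+ s stat as k) ⟩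
    genPoly stat as k + shiftPoly s (genPoly stat as) k ∎
    where open ≡-Reasoning

genPoly-Rav≋prodPoly : ∀ {x y z P} stat → Represents (x ∷ y ∷ z ∷ []) P →
                       genPoly stat (Rav 0 (x ∷ y ∷ z ∷ [])) ≋ onePoly →
                       genPoly stat (Rav 1 (x ∷ y ∷ z ∷ [])) ≋ onePoly →
                       (∀ n → Splitting stat (suc n) (AvoidingRGF (suc n) P) (AvoidingRGF (suc (suc n)) P)) →
                       ∀ n → genPoly stat (Rav n (x ∷ y ∷ z ∷ [])) ≋ prodPoly n
genPoly-Rav≋prodPoly {x} {y} {z} stat rep base₀ base₁ splitting zero = base₀
genPoly-Rav≋prodPoly {x} {y} {z} stat rep base₀ base₁ splitting (suc n) = from-one n
  where
  v : List ℕ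
  v = x ∷ y ∷ z ∷ []
  from-one : ∀ m → genPoly stat (Rav (suc m) v) ≋ prodFrom1 m
  from-one zero = base₁
  from-one (suc m) k = begin
    genPoly stat (Rav (suc (suc m)) v) k
      ≡⟨ genPoly-splitting (∈-Rav⇔ rep) (∈-Rav⇔ rep) (splitting m) k
                           (Rav-unique (suc m) v) (Rav-unique (suc (suc m)) v) ⟩
    genPoly stat (Rav (suc m) v) k + shiftPoly (suc m) (genPoly stat (Rav (suc m) v)) k
      ≡⟨ cong₂ _+_ (from-one m k) (shiftPoly-cong (suc m) (from-one m) k) ⟩
    prodFrom1 m k + shiftPoly (suc m) (prodFrom1 m) k
      ≡⟨ prodFrom1-suc m k ⟨
    prodFrom1 (suc m) k ∎
    where open ≡-Reasoning

appendNewMax : List ℕ → List ℕ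
appendNewMax w = w ++ [ suc (maxL w) ]

appendNewMax-injective : ∀ {u w} → appendNewMax u ≡ appendNewMax w → u ≡ w
appendNewMax-injective {u} {w} = ∷ʳ-injectiveˡ u w

appendNewMax-AvoidingRGF : ∀ {P n w} → LastLetterRecurs P → AvoidingRGF n P w → AvoidingRGF (suc n) P (appendNewMax w)
appendNewMax-AvoidingRGF {P} {w = w} recurs w-avoids = AvoidingRGF-++-[z] w-avoids (s≤s z≤n) ≤-refl no-end-at-new-max
  where
  no-end-at-new-max : ∀ {a b} → a ∷ b ∷ [] ⊆ w → ¬ P a b (suc (maxL w))
  no-end-at-new-max ab⊆w p with recurs p
  ... | inj₁ refl = <-irrefl refl (s≤s (maxL-∈ (lookup ab⊆w (here refl))))
  ... | inj₂ refl = <-irrefl refl (s≤s (maxL-∈ (lookup ab⊆w (there (here refl)))))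

rb-appendNewMax : ∀ w → rb (appendNewMax w) ≡ length w + rb w
rb-appendNewMax w = rb-++-[x]-max (suc (maxL w)) w (All.tabulate (s≤s ∘ maxL-∈))

shiftUp : List ℕ → List ℕ
shiftUp w = 1 ∷ map suc w

shiftUp-injective : ∀ {u w} → shiftUp u ≡ shiftUp w → u ≡ w
shiftUp-injective eq = map-injective suc-injective (proj₂ (∷-injective eq))

isRGF-shiftUp : ∀ {w} → All (1 ≤_) w → isRGF (shiftUp w) ≡ isRGF w
isRGF-shiftUp {w} = isRGF-from-map-suc 0 w

ls-shiftUp : ∀ {w} → All (1 ≤_) w → ls (shiftUp w) ≡ length w + ls w
ls-shiftUp {w} = ls-from-1∷map-suc [] w []

shiftUp-AvoidingRGF : ∀ {P n w} → FirstLetterRecurs P → ShiftInvariant P →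
                      AvoidingRGF n P w → AvoidingRGF (suc n) P (shiftUp w)
shiftUp-AvoidingRGF {P} {w = w} recurs shift w-avoids = record
  { length≡ = cong suc (trans (length-map suc w) length≡)
  ; rgf = subst T (sym (isRGF-shiftUp positive)) rgf
  ; avoids-P = avoid
  }
  where
  open AvoidingRGF w-avoids
  positive : All (1 ≤_) w
  positive = isRGF⇒positive rgf
  ≢1 : ∀ {x} → x ∈ map suc w → 1 ≢ x
  ≢1 x∈ 1≡x with ∈-map⁻ suc x∈
  ... | y , y∈w , refl = <-irrefl (suc-injective 1≡x) (All.lookup positive y∈w)
  avoid : Avoids P (shiftUp w)
  avoid (.1 ∷ʳ abc⊆) p with ⊆-map⁻ suc w abc⊆
  ... | _ ∷ _ ∷ _ ∷ [] , refl , abc′⊆w = avoids-P abc′⊆w (Equivalence.from shift p)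
  avoid (refl ∷ bc⊆) p with recurs p
  ... | inj₁ 1≡b = ≢1 (lookup bc⊆ (here refl)) 1≡b
  ... | inj₂ 1≡c = ≢1 (lookup bc⊆ (there (here refl))) 1≡c

All-2≤⇒map-suc : ∀ r → All (2 ≤_) r → ∃[ w ] (r ≡ map suc w × All (1 ≤_) w)
All-2≤⇒map-suc [] [] = [] , refl , []
All-2≤⇒map-suc (suc x ∷ r) (s≤s 1≤x ∷ 2≤r) with All-2≤⇒map-suc r 2≤r
... | w , refl , 1≤w = x ∷ w , refl , 1≤x ∷ 1≤w

shiftUp⁻ : ∀ {P n r} → ShiftInvariant P → AvoidingRGF (suc n) P (1 ∷ r) → All (2 ≤_) r →
           ∃[ w ] (AvoidingRGF n P w × 1 ∷ r ≡ shiftUp w)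
shiftUp⁻ {P} {r = r} shift r-avoids 2≤r with All-2≤⇒map-suc r 2≤r
... | w , refl , positive = w , w-avoids , refl
  where
  open AvoidingRGF r-avoids
  w-avoids : AvoidingRGF _ P w
  w-avoids = record
    { length≡ = suc-injective (trans (cong suc (sym (length-map suc w))) length≡)
    ; rgf = subst T (isRGF-shiftUp positive) rgf
    ; avoids-P = λ abc⊆w p → avoids-P (1 ∷ʳ map⁺ suc abc⊆w) (Equivalence.to shift p)
    }

-- The four splittings

rb-122-splitting : ∀ n → Splitting rb (suc n) (AvoidingRGF (suc n) Is122) (AvoidingRGF (suc (suc n)) Is122)
rb-122-splitting n = record
  { left = _++ [ 1 ]
  ; right = appendNewMax
  ; left-injective = λ {u} {w} → ∷ʳ-injectiveˡ u w
  ; right-injective = appendNewMax-injective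
  ; left-∈ = λ w-avoids → AvoidingRGF-++-[z] w-avoids ≤-refl (s≤s z≤n) (no-122-ending-in-1 w-avoids)
  ; right-∈ = appendNewMax-AvoidingRGF λ (b≡c , _) → inj₂ (sym b≡c)
  ; left≢right = λ {u} {w} _ w-avoids eq →
      <-irrefl (suc-injective (∷ʳ-injectiveʳ u w eq)) (AvoidingRGF⇒1≤maxL w-avoids)
  ; split = split
  ; stat-left = λ {w} w-avoids → rb-++-[x]-min 1 w (AvoidingRGF⇒positive w-avoids)
  ; stat-right = λ {w} w-avoids → trans (rb-appendNewMax w) (cong (_+ rb w) (AvoidingRGF.length≡ w-avoids))
  }
  where
  no-122-ending-in-1 : ∀ {m u a b} → AvoidingRGF m Is122 u → a ∷ b ∷ [] ⊆ u → ¬ Is122 a b 1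
  no-122-ending-in-1 u-avoids ab⊆u (refl , s≤s a≤0) =
    <-irrefl (sym (n≤0⇒n≡0 a≤0)) (All.lookup (AvoidingRGF⇒positive u-avoids) (lookup ab⊆u (here refl)))
  -- Any other last letter z would complete the occurrence 1 z z, as 1 and z already occur in that order.
  split : ∀ {w′} → AvoidingRGF (suc (suc n)) Is122 w′ →
          ∃[ w ] (AvoidingRGF (suc n) Is122 w × (w′ ≡ w ++ [ 1 ] ⊎ w′ ≡ appendNewMax w))
  split w′-avoids with AvoidingRGF-unsnoc w′-avoids
  ... | u , z , refl , u-avoids , 1≤z , z≤1+max with z ≟ 1 | z ≟ suc (maxL u)
  ...   | yes refl | _ = u , u-avoids , inj₁ refl
  ...   | no _ | yes refl = u , u-avoids , inj₂ refl
  ...   | no z≢1 | no z≢1+max = ⊥-elim (AvoidingRGF.avoids-P w′-avoids (++⁺ [1,z]⊆u ⊆-refl) (refl , 1<z))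
    where
    1<z : 1 < z
    1<z = ≤∧≢⇒< 1≤z (z≢1 ∘ sym)
    [1,z]⊆u : 1 ∷ z ∷ [] ⊆ u
    [1,z]⊆u = isRGF-from⇒[x,y]⊆ u (AvoidingRGF.rgf u-avoids) z<s 1<z (≤-pred (≤∧≢⇒< z≤1+max z≢1+max))

-- A smaller last letter z would complete the occurrence z (maxL u) z.
Is121-avoider-maxL≤last : ∀ {n u z} → AvoidingRGF (suc n) Is121 (u ++ [ z ]) → maxL u ≤ z
Is121-avoider-maxL≤last {u = u} {z} uz-avoids
  with maxL u ≤? z | Equivalence.to (isRGF-++-[z]⇔ {u} {z}) (AvoidingRGF.rgf uz-avoids)
... | yes max≤z | _ = max≤z
... | no max≰z | u-rgf , 1≤z , _ = ⊥-elim (AvoidingRGF.avoids-P uz-avoids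
  (++⁺ (isRGF-from⇒[x,y]⊆ u u-rgf 1≤z (≰⇒> max≰z) ≤-refl) ⊆-refl) (refl , ≰⇒> max≰z))

Is121-avoider-ends-in-maxL : ∀ {n w} → AvoidingRGF (suc n) Is121 w → ∃[ u ] (w ≡ u ++ [ maxL w ])
Is121-avoider-ends-in-maxL w-avoids with AvoidingRGF-unsnoc w-avoids
... | u , z , refl , _ =
  u , cong (λ m → u ++ [ m ]) (sym (trans (maxL-++-[z] u z) (m≤n⇒m⊔n≡n (Is121-avoider-maxL≤last w-avoids))))

rb-121-splitting : ∀ n → Splitting rb (suc n) (AvoidingRGF (suc n) Is121) (AvoidingRGF (suc (suc n)) Is121)
rb-121-splitting n = record
  { left = λ w → w ++ [ maxL w ]
  ; right = appendNewMax
  ; left-injective = λ {u} {w} → ∷ʳ-injectiveˡ u w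
  ; right-injective = appendNewMax-injective
  ; left-∈ = λ {w} w-avoids →
      AvoidingRGF-++-[z] w-avoids (AvoidingRGF⇒1≤maxL w-avoids) (n≤1+n (maxL w)) (no-121-ending-in-max {w})
  ; right-∈ = appendNewMax-AvoidingRGF λ (a≡c , _) → inj₁ (sym a≡c)
  ; left≢right = λ {u} {w} _ _ eq → case ∷ʳ-injective u w eq of λ { (refl , max≡1+max) → 1+n≢n (sym max≡1+max) }
  ; split = split
  ; stat-left = stat-left
  ; stat-right = λ {w} w-avoids → trans (rb-appendNewMax w) (cong (_+ rb w) (AvoidingRGF.length≡ w-avoids))
  }
  where
  no-121-ending-in-max : ∀ {u a b} → a ∷ b ∷ [] ⊆ u → ¬ Is121 a b (maxL u)
  no-121-ending-in-max ab⊆u (refl , a<b) = <⇒≱ a<b (maxL-∈ (lookup ab⊆u (there (here refl))))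
  split : ∀ {w′} → AvoidingRGF (suc (suc n)) Is121 w′ →
          ∃[ w ] (AvoidingRGF (suc n) Is121 w × (w′ ≡ w ++ [ maxL w ] ⊎ w′ ≡ appendNewMax w))
  split w′-avoids with AvoidingRGF-unsnoc w′-avoids
  ... | u , z , refl , u-avoids , _ , z≤1+max with m≤n⇒m<n∨m≡n z≤1+max
  ...   | inj₁ z<1+max =
    u , u-avoids , inj₁ (cong (λ m → u ++ [ m ]) (≤-antisym (≤-pred z<1+max) (Is121-avoider-maxL≤last w′-avoids)))
  ...   | inj₂ refl = u , u-avoids , inj₂ refl
  stat-left : ∀ {w} → AvoidingRGF (suc n) Is121 w → rb (w ++ [ maxL w ]) ≡ rb w
  stat-left {w} w-avoids with Is121-avoider-ends-in-maxL w-avoids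
  ... | u , w≡u++max = subst (λ t → rb (t ++ [ maxL w ]) ≡ rb t) (sym w≡u++max) (rb-++-[x,x] (maxL w) u)

ls-112-splitting : ∀ n → Splitting ls (suc n) (AvoidingRGF (suc n) Is112) (AvoidingRGF (suc (suc n)) Is112)
ls-112-splitting n = record
  { left = _++ [ 1 ]
  ; right = shiftUp
  ; left-injective = λ {u} {w} → ∷ʳ-injectiveˡ u w
  ; right-injective = shiftUp-injective
  ; left-∈ = λ w-avoids → AvoidingRGF-++-[z] w-avoids ≤-refl (s≤s z≤n) λ ab⊆w (_ , a<1) →
      <⇒≱ a<1 (All.lookup (AvoidingRGF⇒positive w-avoids) (lookup ab⊆w (here refl)))
  ; right-∈ = shiftUp-AvoidingRGF (λ (a≡b , _) → inj₁ a≡b) Is112-shift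
  ; left≢right = left≢right
  ; split = split
  ; stat-left = λ {w} w-avoids → ls-from-++-[x]-min 1 [] w [] (AvoidingRGF⇒positive w-avoids)
  ; stat-right = λ {w} w-avoids →
      trans (ls-shiftUp (AvoidingRGF⇒positive w-avoids)) (cong (_+ ls w) (AvoidingRGF.length≡ w-avoids))
  }
  where
  left≢right : ∀ {u w} → AvoidingRGF (suc n) Is112 u → AvoidingRGF (suc n) Is112 w → u ++ [ 1 ] ≢ shiftUp w
  left≢right {u} _ w-avoids eq with AvoidingRGF-unsnoc w-avoids
  ... | w₀ , z , refl , _ , 1≤z , _ =
    <-irrefl (suc-injective (∷ʳ-injectiveʳ u (shiftUp w₀) (trans eq (cong (1 ∷_) (map-++ suc w₀ [ z ]))))) 1≤z
  -- A last letter z ≠ 1 rules out any further 1 (it would give 1 1 z), so the word is a shiftUp.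
  split : ∀ {w′} → AvoidingRGF (suc (suc n)) Is112 w′ →
          ∃[ w ] (AvoidingRGF (suc n) Is112 w × (w′ ≡ w ++ [ 1 ] ⊎ w′ ≡ shiftUp w))
  split w′-avoids with AvoidingRGF-unsnoc w′-avoids
  ... | u , z , refl , u-avoids , 1≤z , _ with z ≟ 1
  ...   | yes refl = u , u-avoids , inj₁ refl
  ...   | no z≢1 with AvoidingRGF-head u-avoids
  ...     | r₀ , refl with shiftUp⁻ Is112-shift w′-avoids (All.tabulate 2≤)
    where
    1<z : 1 < z
    1<z = ≤∧≢⇒< 1≤z (z≢1 ∘ sym)
    2≤ : ∀ {y} → y ∈ r₀ ++ [ z ] → 2 ≤ y
    2≤ {y} y∈ with ∈-++⁻ r₀ y∈
    ... | inj₂ (here refl) = 1<z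
    ... | inj₁ y∈r₀ with y ≟ 1
    ...   | yes refl = ⊥-elim (AvoidingRGF.avoids-P w′-avoids (refl ∷ ++⁺ (from∈ y∈r₀) ⊆-refl) (refl , 1<z))
    ...   | no y≢1 = ≤∧≢⇒< (All.lookup (AvoidingRGF⇒positive u-avoids) (there y∈r₀)) (y≢1 ∘ sym)
  ...       | w , w-avoids , eq = w , w-avoids , inj₂ eq

ls-121-splitting : ∀ n → Splitting ls (suc n) (AvoidingRGF (suc n) Is121) (AvoidingRGF (suc (suc n)) Is121)
ls-121-splitting n = record
  { left = 1 ∷_
  ; right = shiftUp
  ; left-injective = λ eq → proj₂ (∷-injective eq)
  ; right-injective = shiftUp-injective
  ; left-∈ = left-∈
  ; right-∈ = shiftUp-AvoidingRGF (λ (a≡c , _) → inj₂ a≡c) Is121-shift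
  ; left≢right = left≢right
  ; split = split
  ; stat-left = stat-left
  ; stat-right = λ {w} w-avoids →
      trans (ls-shiftUp (AvoidingRGF⇒positive w-avoids)) (cong (_+ ls w) (AvoidingRGF.length≡ w-avoids))
  }
  where
  left-∈ : ∀ {w} → AvoidingRGF (suc n) Is121 w → AvoidingRGF (suc (suc n)) Is121 (1 ∷ w)
  left-∈ w-avoids with AvoidingRGF-head w-avoids
  ... | r , refl = record { length≡ = cong suc length≡ ; rgf = rgf ; avoids-P = avoid }
    where
    open AvoidingRGF w-avoids
    avoid : Avoids Is121 (1 ∷ 1 ∷ r)
    avoid (.1 ∷ʳ abc⊆) = avoids-P abc⊆
    avoid (refl ∷ .1 ∷ʳ bc⊆) = avoids-P (refl ∷ bc⊆)
    avoid (refl ∷ refl ∷ _) (_ , 1<1) = <-irrefl refl 1<1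
  left≢right : ∀ {u w} → AvoidingRGF (suc n) Is121 u → AvoidingRGF (suc n) Is121 w → 1 ∷ u ≢ shiftUp w
  left≢right u-avoids w-avoids eq with AvoidingRGF-head u-avoids | AvoidingRGF-head w-avoids
  ... | _ , refl | _ , refl with () ← proj₁ (∷-injective (proj₂ (∷-injective eq)))
  -- A second letter 2 rules out any later 1 (it would give 1 2 1), so the word is a shiftUp.
  split : ∀ {w′} → AvoidingRGF (suc (suc n)) Is121 w′ →
          ∃[ w ] (AvoidingRGF (suc n) Is121 w × (w′ ≡ 1 ∷ w ⊎ w′ ≡ shiftUp w))
  split w′-avoids with AvoidingRGF-head w′-avoids
  ... | [] , refl with () ← AvoidingRGF.length≡ w′-avoids
  ... | y ∷ r , refl with Equivalence.to (isRGF-from-∷⇔ {w = r}) (AvoidingRGF.rgf w′-avoids) | y ≟ 1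
  ...   | _ | yes refl = 1 ∷ r , tail , inj₁ refl
    where
    open AvoidingRGF w′-avoids
    tail : AvoidingRGF (suc n) Is121 (1 ∷ r)
    tail = record { length≡ = suc-injective length≡ ; rgf = rgf ; avoids-P = Avoids-⊆ (1 ∷ʳ ⊆-refl) avoids-P }
  ...   | 1≤y , _ | no y≢1 with shiftUp⁻ Is121-shift w′-avoids (2≤y ∷ All.tabulate 2≤)
    where
    2≤y : 2 ≤ y
    2≤y = ≤∧≢⇒< 1≤y (y≢1 ∘ sym)
    2≤ : ∀ {t} → t ∈ r → 2 ≤ t
    2≤ {t} t∈r with t ≟ 1
    ... | yes refl = ⊥-elim (AvoidingRGF.avoids-P w′-avoids (refl ∷ refl ∷ from∈ t∈r) (refl , 2≤y))
    ... | no t≢1 = ≤∧≢⇒< (All.lookup (AvoidingRGF⇒positive w′-avoids) (there (there t∈r))) (t≢1 ∘ sym)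
  ...     | w , w-avoids , eq = w , w-avoids , inj₂ eq
  stat-left : ∀ {w} → AvoidingRGF (suc n) Is121 w → ls (1 ∷ w) ≡ ls w
  stat-left w-avoids with AvoidingRGF-head w-avoids
  ... | r , refl = ls-from-cong r (mk⇔ (λ { (here refl) → here refl ; (there 1∈) → 1∈ }) there)

-- The cases n = 0, 1 hold by evaluation: R₀(v) = {ε} and R₁(v) = {1}, both of statistic 0.
LS-112 : ∀ n → LS n (1 ∷ 1 ∷ 2 ∷ []) ≋ prodPoly n
LS-112 = genPoly-Rav≋prodPoly ls represents-112 (λ { zero → refl ; (suc _) → refl })
                                                  (λ { zero → refl ; (suc _) → refl }) ls-112-splitting

LS-121 : ∀ n → LS n (1 ∷ 2 ∷ 1 ∷ []) ≋ prodPoly n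
LS-121 = genPoly-Rav≋prodPoly ls represents-121 (λ { zero → refl ; (suc _) → refl })
                                                  (λ { zero → refl ; (suc _) → refl }) ls-121-splitting

RB-121 : ∀ n → RB n (1 ∷ 2 ∷ 1 ∷ []) ≋ prodPoly n
RB-121 = genPoly-Rav≋prodPoly rb represents-121 (λ { zero → refl ; (suc _) → refl })
                                                  (λ { zero → refl ; (suc _) → refl }) rb-121-splitting

RB-122 : ∀ n → RB n (1 ∷ 2 ∷ 2 ∷ []) ≋ prodPoly n
RB-122 = genPoly-Rav≋prodPoly rb represents-122 (λ { zero → refl ; (suc _) → refl })
                                                  (λ { zero → refl ; (suc _) → refl }) rb-122-splitting

theorem2p7 : (n : ℕ) →
    (LS n (1 ∷ 1 ∷ 2 ∷ []) ≋ prodPoly n) × (LS n (1 ∷ 2 ∷ 1 ∷ []) ≋ prodPoly n) ×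
      (RB n (1 ∷ 2 ∷ 1 ∷ []) ≋ prodPoly n) × (RB n (1 ∷ 2 ∷ 2 ∷ []) ≋ prodPoly n)
theorem2p7 n = LS-112 n , LS-121 n , RB-121 n , RB-122 n
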